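{- Let $m \geq 1$ and let $n = p_1 p_2 \cdots p_m$, where $p_1 < p_2 < \cdots < p_m$ are primes. Then the zero-divisor graph $\Gamma(\mathbb{Z}_n)$ is a very cost effective graph.
   Context: $\mathbb{Z}_n$ is the ring of residue classes modulo $n$. The zero-divisor graph $\Gamma(\mathbb{Z}_n)$ has as vertices the nonzero zero-divisors of $\mathbb{Z}_n$ (nonzero $z$ such that $rz=0$ for some nonzero $r$), two distinct vertices $x,y$ being adjacent iff $xy = 0$. For a graph $G=(V,E)$, $N(v)$ denotes the open neighborhood of $v$. Given $S \subseteq V$, a vertex $v \in S$ is very cost effective if $|N(v)\cap S| < |N(v) \cap (V\setminus S)|$; a set $S$ is very cost effective if every vertex of $S$ is very cost effective. A bipartition $\{S, V\setminus S\}$ of $V$ is very cost effective if both $S$ and $V \setminus S$ are very cost effective sets, and $G$ is a very cost effective graph if it has a very cost effective bipartition. -}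

module Defs where

open import Data.Nat using (ℕ; _*_; _<_)
open import Data.Nat.Divisibility using (_∣_; _∣?_)
open import Data.Fin using (Fin; toℕ)
open import Data.Fin.Properties using (any?)
import Data.Fin.Properties as FinP
open import Data.Fin.Subset using (Subset; _∈_; _⊆_; _∩_; _─_; ∣_∣)
open import Data.Vec using (tabulate)
open import Data.Product using (Σ; _×_; _,_; ∃)
open import Relation.Nullary using (¬_; Dec; does; _×-dec_; ¬?)
open import Relation.Binary.PropositionalEquality using (_≡_)
import Data.Nat as ℕ

-- Residues of ℤ_n are represented by Fin n (i.e. 0,1,…,n-1);
-- the ring identity  r * x = 0  in ℤ_n  is  n ∣ r * x  in ℕ.

IsZeroDivisor : (n : ℕ) → Fin n → Set
IsZeroDivisor n x =
  ¬ (toℕ x ≡ 0) × ∃ λ (r : Fin n) → ¬ (toℕ r ≡ 0) × (n ∣ toℕ r * toℕ x)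

isZeroDivisor? : (n : ℕ) (x : Fin n) → Dec (IsZeroDivisor n x)
isZeroDivisor? n x =
  ¬? (toℕ x ℕ.≟ 0) ×-dec any? (λ r → ¬? (toℕ r ℕ.≟ 0) ×-dec (n ∣? (toℕ r * toℕ x)))

V : (n : ℕ) → Subset n
V n = tabulate (λ x → does (isZeroDivisor? n x))

Adj : (n : ℕ) → Fin n → Fin n → Set
Adj n x y = ¬ (x ≡ y) × (n ∣ toℕ x * toℕ y)

adj? : (n : ℕ) (x y : Fin n) → Dec (Adj n x y)
adj? n x y = ¬? (x FinP.≟ y) ×-dec (n ∣? (toℕ x * toℕ y))

N : (n : ℕ) → Fin n → Subset n
N n v = tabulate (λ y → does (adj? n v y)) ∩ V n

VeryCostEffectiveVertex : (n : ℕ) → Subset n → Fin n → Set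
VeryCostEffectiveVertex n S v = ∣ N n v ∩ S ∣ < ∣ N n v ∩ (V n ─ S) ∣

VeryCostEffectiveSet : (n : ℕ) → Subset n → Set
VeryCostEffectiveSet n S = ∀ v → v ∈ S → VeryCostEffectiveVertex n S v

VeryCostEffectiveGraph : (n : ℕ) → Set
VeryCostEffectiveGraph n =
  Σ (Subset n) λ S → (S ⊆ V n) × VeryCostEffectiveSet n S × VeryCostEffectiveSet n (V n ─ S)

module Submission where

-- Write n = p · q with p = p₁ the smallest prime, so that p ∤ q, and split
-- the vertex set V into S = { v ∈ V | p ∣ v } and V ∖ S.
--  * A vertex v ∉ S has all its neighbours in S: from n ∣ v y and p ∤ v,
--    Euclid gives p ∣ y.  Since v is a zero-divisor it has at least one
--    neighbour, so v is very cost effective for V ∖ S (0 < 1).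
--  * For a vertex v ∈ S, translation y ↦ y + q (mod n) maps N(v) ∩ S
--    injectively into N(v) ∖ S (it kills divisibility by p and preserves
--    v y ≡ 0, as v q ≡ 0), and misses q = 0 + q, which lies in N(v) ∖ S
--    because 0 is not a vertex.

open import Defs
open import Data.Nat using (ℕ; _≤_; _<_)
open import Data.Nat.Primality using (Prime)
open import Data.Fin using (Fin)
import Data.Fin as F
open import Data.List using (tabulate)
open import Data.Nat.ListAction using (product)
open import Relation.Binary.PropositionalEquality using (_≡_)

open import Data.Nat using (zero; suc; _+_; _*_; _∸_; _%_; z≤n; s≤s; NonZero; ≢-nonZero; >-nonZero⁻¹; nonTrivial⇒n>1)
open import Data.Nat.Properties
  using (≤-trans; ≤-<-trans; <⇒≤; <-irrefl; *-comm; +-assoc; *-distribˡ-+; m+[n∸m]≡n; m<m*n; m*n≢0)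
open import Data.Nat.Divisibility
  using (_∣_; _∣?_; divides; ∣-trans; _∣0; ∣1⇒≡1; ∣m+n∣m⇒∣n; ∣m∣n⇒∣m+n; ∣n∣m%n⇒∣m;
         *-monoˡ-∣; m%n≡0⇒n∣m; n∣m⇒m%n≡0)
open import Data.Nat.DivMod using (_mod_; m%n%n≡m%n; [m+n]%n≡m%n; m<n⇒m%n≡m; %-distribˡ-+; %-distribˡ-*)
open import Data.Nat.Primality using (euclidsLemma; prime⇒irreducible; prime⇒nonZero; prime⇒nonTrivial; ¬prime[1])
open import Data.Fin using (toℕ; fromℕ<)
open import Data.Fin.Properties using (toℕ-injective; toℕ<n; toℕ-fromℕ<; 0≢1+n; suc-injective)
open import Data.Fin.Subset using (Subset; _∈_; _∉_; _⊆_; _∩_; _─_; _-_; ∣_∣; Empty; inside; outside)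
open import Data.Fin.Subset.Properties
  using (x∈p∩q⁺; x∈p∩q⁻; x∈p∧x∉q⇒x∈p─q; p─q⊆p; x∈p∧x≢y⇒x∈p-y; x∈p⇒∣p-x∣<∣p∣; Empty-unique; ∣⊥∣≡0)
import Data.Vec as Vec
open import Data.Vec using ([]; _∷_; here; there)
open import Data.Vec.Properties using ([]=⇒lookup; lookup⇒[]=; lookup∘tabulate)
open import Data.Product using (_×_; _,_; proj₁; proj₂)
open import Data.Sum using (inj₁; inj₂)
open import Data.Empty using (⊥-elim)
open import Data.Bool using (true)
open import Relation.Nullary using (¬_; Dec; yes; does)
open import Relation.Nullary.Decidable using (dec-true)
open import Relation.Binary.PropositionalEquality using (sym; trans; cong; subst; _≢_; module ≡-Reasoning)
open import Function using (_∘_)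

∈-tabulate⁺ : ∀ {n} {P : Fin n → Set} (P? : ∀ x → Dec (P x)) {x : Fin n}
            → P x → x ∈ Vec.tabulate (does ∘ P?)
∈-tabulate⁺ P? {x} px = lookup⇒[]= x _ (trans (lookup∘tabulate _ x) (dec-true (P? x) px))

∈-tabulate⁻ : ∀ {n} {P : Fin n → Set} (P? : ∀ x → Dec (P x)) {x : Fin n}
            → x ∈ Vec.tabulate (does ∘ P?) → P x
∈-tabulate⁻ P? {x} x∈ = fromDoes (P? x) (trans (sym (lookup∘tabulate _ x)) ([]=⇒lookup x∈))
  where
  fromDoes : ∀ {A : Set} (A? : Dec A) → does A? ≡ true → A
  fromDoes (yes a) _ = a

x∈p─q⇒x∉q : ∀ {n} (p q : Subset n) {x} → x ∈ p ─ q → x ∉ q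
x∈p─q⇒x∉q (_ ∷ p) (outside ∷ q) here        ()
x∈p─q⇒x∉q (_ ∷ p) (_       ∷ q) (there x∈) (there x∈q) = x∈p─q⇒x∉q p q x∈ x∈q

injection⇒∣≤∣ : ∀ {n k} (A : Subset n) (B : Subset k) (f : Fin n → Fin k)
              → (∀ x → x ∈ A → f x ∈ B)
              → (∀ x y → x ∈ A → y ∈ A → f x ≡ f y → x ≡ y)
              → ∣ A ∣ ≤ ∣ B ∣
injection⇒∣≤∣ [] B f _ _ = z≤n
injection⇒∣≤∣ (outside ∷ A) B f maps inj =
  injection⇒∣≤∣ A B (f ∘ F.suc) (λ x x∈ → maps (F.suc x) (there x∈))
    (λ x y x∈ y∈ e → suc-injective (inj _ _ (there x∈) (there y∈) e))
injection⇒∣≤∣ (inside ∷ A) B f maps inj =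
  ≤-trans (s≤s (injection⇒∣≤∣ A (B - f F.zero) (f ∘ F.suc) avoidsImage₀ injective))
          (x∈p⇒∣p-x∣<∣p∣ (maps F.zero here))
  where
  avoidsImage₀ : ∀ x → x ∈ A → f (F.suc x) ∈ B - f F.zero
  avoidsImage₀ x x∈ = x∈p∧x≢y⇒x∈p-y (maps (F.suc x) (there x∈))
                        (λ e → 0≢1+n (sym (inj _ _ (there x∈) here e)))
  injective : ∀ x y → x ∈ A → y ∈ A → f (F.suc x) ≡ f (F.suc y) → x ≡ y
  injective x y x∈ y∈ e = suc-injective (inj _ _ (there x∈) (there y∈) e)

injection-missing⇒∣<∣ : ∀ {n k} (A : Subset n) (B : Subset k) (f : Fin n → Fin k) (z : Fin k)
                      → z ∈ B
                      → (∀ x → x ∈ A → f x ∈ B × f x ≢ z)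
                      → (∀ x y → x ∈ A → y ∈ A → f x ≡ f y → x ≡ y)
                      → ∣ A ∣ < ∣ B ∣
injection-missing⇒∣<∣ A B f z z∈B maps inj =
  ≤-<-trans (injection⇒∣≤∣ A (B - z) f (λ x x∈ → x∈p∧x≢y⇒x∈p-y (proj₁ (maps x x∈)) (proj₂ (maps x x∈))) inj)
            (x∈p⇒∣p-x∣<∣p∣ z∈B)

empty⇒∣<∣ : ∀ {n} (A B : Subset n) {z} → Empty A → z ∈ B → ∣ A ∣ < ∣ B ∣
empty⇒∣<∣ {n} A B empty z∈B =
  subst (_< ∣ B ∣) (sym (trans (cong ∣_∣ (Empty-unique empty)) (∣⊥∣≡0 n)))
        (≤-<-trans z≤n (x∈p⇒∣p-x∣<∣p∣ z∈B))

prime∤product-of-larger : ∀ k (g : Fin k → ℕ) {p} → Prime p → (∀ i → Prime (g i))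
                        → (∀ i → p < g i) → ¬ p ∣ product (tabulate g)
prime∤product-of-larger zero g pp _ _ p∣1 = ¬prime[1] (subst Prime (∣1⇒≡1 p∣1) pp)
prime∤product-of-larger (suc k) g {p} pp pg p<g p∣gs
  with euclidsLemma (g F.zero) (product (tabulate (g ∘ F.suc))) pp p∣gs
... | inj₂ p∣rest = prime∤product-of-larger k (g ∘ F.suc) pp (pg ∘ F.suc) (p<g ∘ F.suc) p∣rest
... | inj₁ p∣g₀ with prime⇒irreducible (pg F.zero) p∣g₀
...   | inj₁ p≡1  = ¬prime[1] (subst Prime p≡1 pp)
...   | inj₂ p≡g₀ = <-irrefl p≡g₀ (p<g F.zero)

∣*-reduce : ∀ {n} .{{_ : NonZero n}} v x → n ∣ v * x → n ∣ v * (x % n)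
∣*-reduce {n} v x n∣vx = m%n≡0⇒n∣m _ n (begin
  (v * (x % n)) % n          ≡⟨ %-distribˡ-* v (x % n) n ⟩
  (v % n * (x % n % n)) % n  ≡⟨ cong (λ t → (v % n * t) % n) (m%n%n≡m%n x n) ⟩
  (v % n * (x % n)) % n      ≡⟨ %-distribˡ-* v x n ⟨
  (v * x) % n                ≡⟨ n∣m⇒m%n≡0 _ n n∣vx ⟩
  0                          ∎)
  where open ≡-Reasoning

module Translation (n q : ℕ) .{{_ : NonZero n}} (q≤n : q ≤ n) where

  shift : ℕ → ℕ
  shift a = (a + q) % n

  unshift-shift : ∀ {a} → a < n → (shift a + (n ∸ q)) % n ≡ a
  unshift-shift {a} a<n = begin
    (shift a + (n ∸ q)) % n                   ≡⟨ %-distribˡ-+ (shift a) (n ∸ q) n ⟩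
    (shift a % n + (n ∸ q) % n) % n           ≡⟨ cong (λ t → (t + (n ∸ q) % n) % n) (m%n%n≡m%n (a + q) n) ⟩
    ((a + q) % n + (n ∸ q) % n) % n           ≡⟨ %-distribˡ-+ (a + q) (n ∸ q) n ⟨
    (a + q + (n ∸ q)) % n                     ≡⟨ cong (_% n) (+-assoc a q (n ∸ q)) ⟩
    (a + (q + (n ∸ q))) % n                   ≡⟨ cong (λ t → (a + t) % n) (m+[n∸m]≡n q≤n) ⟩
    (a + n) % n                               ≡⟨ [m+n]%n≡m%n a n ⟩
    a % n                                     ≡⟨ m<n⇒m%n≡m a<n ⟩
    a                                         ∎
    where open ≡-Reasoning

  shift-injective : ∀ {a b} → a < n → b < n → shift a ≡ shift b → a ≡ b
  shift-injective {a} {b} a<n b<n e =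
    trans (sym (unshift-shift a<n)) (trans (cong (λ t → (t + (n ∸ q)) % n) e) (unshift-shift b<n))

  shift-annihilated : ∀ {v a} → n ∣ v * a → n ∣ v * q → n ∣ v * shift a
  shift-annihilated {v} {a} n∣va n∣vq =
    ∣*-reduce v (a + q) (subst (n ∣_) (sym (*-distribˡ-+ v a q)) (∣m∣n⇒∣m+n n∣va n∣vq))

  shift-¬∣ : ∀ {d a} → d ∣ n → d ∣ a → ¬ d ∣ q → ¬ d ∣ shift a
  shift-¬∣ d∣n d∣a d∤q d∣shift = d∤q (∣m+n∣m⇒∣n (∣n∣m%n⇒∣m d∣n d∣shift) d∣a)

  shiftFin : Fin n → Fin n
  shiftFin y = (toℕ y + q) mod n

  toℕ-shiftFin : ∀ y → toℕ (shiftFin y) ≡ shift (toℕ y)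
  toℕ-shiftFin y = toℕ-fromℕ< _

module Graph (n : ℕ) where

  vertex⁻ : ∀ {x} → x ∈ V n → IsZeroDivisor n x
  vertex⁻ = ∈-tabulate⁻ (isZeroDivisor? n)

  vertex⁺ : ∀ {v x} → toℕ v ≢ 0 → toℕ x ≢ 0 → n ∣ toℕ v * toℕ x → x ∈ V n
  vertex⁺ {v} v≢0 x≢0 n∣vx = ∈-tabulate⁺ (isZeroDivisor? n) (x≢0 , v , v≢0 , n∣vx)

  neighbour⁻ : ∀ v {y} → y ∈ N n v → Adj n v y × y ∈ V n
  neighbour⁻ v y∈ with x∈p∩q⁻ _ _ y∈
  ... | y∈adj , y∈V = ∈-tabulate⁻ (adj? n v) y∈adj , y∈V

  neighbour⁺ : ∀ {v y} → v ∈ V n → toℕ y ≢ 0 → v ≢ y → n ∣ toℕ v * toℕ y → y ∈ N n v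
  neighbour⁺ {v} v∈V y≢0 v≢y n∣vy =
    x∈p∩q⁺ (∈-tabulate⁺ (adj? n v) (v≢y , n∣vy) , vertex⁺ (proj₁ (vertex⁻ v∈V)) y≢0 n∣vy)

module PrimeSplit (n p q : ℕ) (n≡pq : n ≡ p * q) (p-prime : Prime p) (p∤q : ¬ p ∣ q) where

  open Graph n

  p∣n : p ∣ n
  p∣n = divides q (trans n≡pq (*-comm p q))

  q≢0 : q ≢ 0
  q≢0 q≡0 = p∤q (subst (p ∣_) (sym q≡0) (p ∣0))

  instance
    q-nonZero : NonZero q
    q-nonZero = ≢-nonZero q≢0

    n-nonZero : NonZero n
    n-nonZero = subst NonZero (sym n≡pq) (m*n≢0 p q {{prime⇒nonZero p-prime}})

  q<n : q < n
  q<n = subst (q <_) (trans (*-comm q p) (sym n≡pq))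
              (m<m*n q p (nonTrivial⇒n>1 p {{prime⇒nonTrivial p-prime}}))

  ¬∣⇒≢0 : ∀ {a} → ¬ p ∣ a → a ≢ 0
  ¬∣⇒≢0 p∤a a≡0 = p∤a (subst (p ∣_) (sym a≡0) (p ∣0))

  -- the class of the vertices divisible by p ("marked" residues)
  S : Subset n
  S = V n ∩ Vec.tabulate (λ x → does (p ∣? toℕ x))

  S⊆V : S ⊆ V n
  S⊆V x∈S = proj₁ (x∈p∩q⁻ _ _ x∈S)

  ∈S⁻ : ∀ {y} → y ∈ S → p ∣ toℕ y
  ∈S⁻ y∈S = ∈-tabulate⁻ (λ x → p ∣? toℕ x) (proj₂ (x∈p∩q⁻ _ _ y∈S))

  ∈S⁺ : ∀ {y} → y ∈ V n → p ∣ toℕ y → y ∈ S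
  ∈S⁺ y∈V p∣y = x∈p∩q⁺ (y∈V , ∈-tabulate⁺ (λ x → p ∣? toℕ x) p∣y)

  ∈V─S⁻ : ∀ {y} → y ∈ V n ─ S → y ∈ V n × ¬ p ∣ toℕ y
  ∈V─S⁻ y∈ = p─q⊆p (V n) S y∈ , λ p∣y → x∈p─q⇒x∉q (V n) S y∈ (∈S⁺ (p─q⊆p (V n) S y∈) p∣y)

  ∈V─S⁺ : ∀ {y} → y ∈ V n → ¬ p ∣ toℕ y → y ∈ V n ─ S
  ∈V─S⁺ y∈V p∤y = x∈p∧x∉q⇒x∈p─q y∈V (p∤y ∘ ∈S⁻)

  ∈V─[V─S]⁺ : ∀ {y} → y ∈ V n → p ∣ toℕ y → y ∈ V n ─ (V n ─ S)
  ∈V─[V─S]⁺ y∈V p∣y = x∈p∧x∉q⇒x∈p─q y∈V (λ y∈ → proj₂ (∈V─S⁻ y∈) p∣y)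

  neighbour-of-unmarked : ∀ {v y : Fin n} → ¬ p ∣ toℕ v → n ∣ toℕ v * toℕ y → p ∣ toℕ y
  neighbour-of-unmarked p∤v n∣vy with euclidsLemma _ _ p-prime (∣-trans p∣n n∣vy)
  ... | inj₁ p∣v = ⊥-elim (p∤v p∣v)
  ... | inj₂ p∣y = p∣y

  -- Vertices outside S: no neighbour outside S, but some neighbour in S.
  outside-costEffective : ∀ v → v ∈ V n ─ S → VeryCostEffectiveVertex n (V n ─ S) v
  outside-costEffective v v∈ with ∈V─S⁻ v∈
  ... | v∈V , p∤v with vertex⁻ v∈V
  ... | v≢0 , r , r≢0 , n∣rv = empty⇒∣<∣ _ _ noUnmarkedNeighbour r∈
    where
    n∣vr : n ∣ toℕ v * toℕ r
    n∣vr = subst (n ∣_) (*-comm (toℕ r) (toℕ v)) n∣rv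
    p∣r : p ∣ toℕ r
    p∣r = neighbour-of-unmarked p∤v n∣vr
    r∈ : r ∈ N n v ∩ (V n ─ (V n ─ S))
    r∈ = x∈p∩q⁺ ( neighbour⁺ v∈V r≢0 (λ v≡r → p∤v (subst (λ t → p ∣ toℕ t) (sym v≡r) p∣r)) n∣vr
                , ∈V─[V─S]⁺ (vertex⁺ v≢0 r≢0 n∣vr) p∣r)
    noUnmarkedNeighbour : Empty (N n v ∩ (V n ─ S))
    noUnmarkedNeighbour (y , y∈) with x∈p∩q⁻ _ _ y∈
    ... | y∈N , y∈V─S = proj₂ (∈V─S⁻ y∈V─S) (neighbour-of-unmarked p∤v (proj₂ (proj₁ (neighbour⁻ v y∈N))))

  open Translation n q (<⇒≤ q<n)

  q̂ : Fin n
  q̂ = fromℕ< q<n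

  toℕ-q̂ : toℕ q̂ ≡ q
  toℕ-q̂ = toℕ-fromℕ< q<n

  unmarked-neighbour : ∀ {v w : Fin n} → v ∈ V n → p ∣ toℕ v → ¬ p ∣ toℕ w → n ∣ toℕ v * toℕ w
                     → w ∈ N n v ∩ (V n ─ S)
  unmarked-neighbour {v} {w} v∈V p∣v p∤w n∣vw =
    x∈p∩q⁺ ( neighbour⁺ v∈V (¬∣⇒≢0 p∤w) (λ v≡w → p∤w (subst (λ t → p ∣ toℕ t) v≡w p∣v)) n∣vw
           , ∈V─S⁺ (vertex⁺ (proj₁ (vertex⁻ v∈V)) (¬∣⇒≢0 p∤w) n∣vw) p∤w)

  -- Vertices in S: translation by q sends N(v) ∩ S injectively into
  -- N(v) ∖ S, missing q itself.
  inside-costEffective : ∀ v → v ∈ S → VeryCostEffectiveVertex n S v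
  inside-costEffective v v∈S =
    injection-missing⇒∣<∣ _ _ shiftFin q̂ q̂∈ maps (λ x y _ _ → shiftFin-injective x y)
    where
    v∈V : v ∈ V n
    v∈V = S⊆V v∈S
    p∣v : p ∣ toℕ v
    p∣v = ∈S⁻ v∈S
    n∣vq : n ∣ toℕ v * q
    n∣vq = subst (_∣ toℕ v * q) (sym n≡pq) (*-monoˡ-∣ q p∣v)
    p∤q̂ : ¬ p ∣ toℕ q̂
    p∤q̂ p∣q̂ = p∤q (subst (p ∣_) toℕ-q̂ p∣q̂)
    q̂∈ : q̂ ∈ N n v ∩ (V n ─ S)
    q̂∈ = unmarked-neighbour v∈V p∣v p∤q̂ (subst (λ t → n ∣ toℕ v * t) (sym toℕ-q̂) n∣vq)
    shiftFin-injective : ∀ x y → shiftFin x ≡ shiftFin y → x ≡ y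
    shiftFin-injective x y e = toℕ-injective (shift-injective (toℕ<n x) (toℕ<n y)
      (trans (sym (toℕ-shiftFin x)) (trans (cong toℕ e) (toℕ-shiftFin y))))
    -- only 0 is translated to q, and 0 is not a vertex
    shift≡q⇒≡0 : ∀ y → shiftFin y ≡ q̂ → toℕ y ≡ 0
    shift≡q⇒≡0 y e = shift-injective (toℕ<n y) (>-nonZero⁻¹ n)
      (trans (sym (toℕ-shiftFin y)) (trans (cong toℕ e) (trans toℕ-q̂ (sym (m<n⇒m%n≡m q<n)))))
    maps : ∀ y → y ∈ N n v ∩ S → shiftFin y ∈ N n v ∩ (V n ─ S) × shiftFin y ≢ q̂
    maps y y∈ with x∈p∩q⁻ _ _ y∈
    ... | y∈N , y∈S with neighbour⁻ v y∈N
    ... | (_ , n∣vy) , y∈V = unmarked-neighbour v∈V p∣v p∤ŷ n∣vŷ , proj₁ (vertex⁻ y∈V) ∘ shift≡q⇒≡0 y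
      where
      p∤ŷ : ¬ p ∣ toℕ (shiftFin y)
      p∤ŷ p∣ŷ = shift-¬∣ p∣n (∈S⁻ y∈S) p∤q (subst (p ∣_) (toℕ-shiftFin y) p∣ŷ)
      n∣vŷ : n ∣ toℕ v * toℕ (shiftFin y)
      n∣vŷ = subst (λ t → n ∣ toℕ v * t) (sym (toℕ-shiftFin y)) (shift-annihilated {toℕ v} n∣vy n∣vq)

  veryCostEffective : VeryCostEffectiveGraph n
  veryCostEffective = S , S⊆V , inside-costEffective , outside-costEffective

-- Main theorem: n = p₁ · (p₂ ⋯ p_m), and p₁ ∤ p₂ ⋯ p_m since p₁ < p₂ < ⋯ < p_m.
mainTheorem1 : (m : ℕ) → 1 ≤ m → (p : Fin m → ℕ) → (∀ i → Prime (p i))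
    → (∀ i j → i F.< j → p i < p j)
    → (n : ℕ) → n ≡ product (tabulate p) → VeryCostEffectiveGraph n
mainTheorem1 zero () p p-prime p-increasing n n≡∏p
mainTheorem1 (suc k) _ p p-prime p-increasing n n≡∏p =
  PrimeSplit.veryCostEffective n (p F.zero) (product (tabulate (p ∘ F.suc))) n≡∏p (p-prime F.zero)
    (prime∤product-of-larger k (p ∘ F.suc) (p-prime F.zero) (p-prime ∘ F.suc)
       (λ i → p-increasing F.zero (F.suc i) (s≤s z≤n)))
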